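{- For any $P\in\mathrm{Part}(\Sigma)$: (1) $\mathrm{GVrefiners}(P) = \varnothing$ iff $\mathrm{refiners}_{\mathbf{EU}}^{\mathrm{Part}}(P)= \varnothing$; (2) for all $B_1,B_2\in P$, $\mathrm{GVsplit}(\langle B_1,B_2\rangle,P) = \mathrm{refine}_{\mathbf{EU}}^{\mathrm{Part}}(\langle B_1,B_2\rangle,P)$.
   Context: Let $(\Sigma,\to,\ell)$ be a finite Kripke structure with total transition relation $\to$. The existential until $\mathbf{EU}:\wp(\Sigma)^2\to\wp(\Sigma)$ is $\mathbf{EU}(S_1,S_2)=S_2\cup\{s\in S_1~|~\exists s_0,\dots,s_n\ (n\ge0),\ s_0=s,\ \forall i<n.\ s_i\in S_1,\ s_i\to s_{i+1},\ s_n\in S_2\}$. $\mathrm{Part}(\Sigma)$ is the lattice of partitions ordered by refinement $\preceq$ with meet $\curlywedge$; $\complement$ is complement in $\Sigma$. $\mathrm{GVsplit}(\langle B_1,B_2\rangle,P)=P\curlywedge\{\mathbf{EU}(B_1,B_2),\complement(\mathbf{EU}(B_1,B_2))\}$ and $\mathrm{GVrefiners}(P)=\{\langle B_1,B_2\rangle\in P\times P~|~\mathrm{GVsplit}(\langle B_1,B_2\rangle,P)\prec P\}$. For a partition $P$, $\mathrm{pad}(P)$ is the abstract domain whose image is all unions of blocks of $P$; the partition abstraction of an abstract domain $A$ is $\mathrm{par}(A)$ (states identified when their abstractions coincide). For $f$ of arity $n$ and $\vec S\in\wp(\Sigma)^n$, $\mathrm{refine}_f^{\mathrm{Part}}(\vec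 S,P)=\mathrm{par}(\mathrm{pad}(P)\sqcap\mathcal{M}(\{f(\vec S)\}))$ (which equals $P\curlywedge\{f(\vec S),\complement(f(\vec S))\}$), where $\mathcal{M}$ is Moore closure and $\sqcap$ is reduced product of abstract domains; and $\mathrm{refiners}_f^{\mathrm{Part}}(P)=\{\vec S\in\mathrm{pad}(P)^{n}~|~\mathrm{refine}_f^{\mathrm{Part}}(\vec S,P)\prec P\}$, i.e. tuples of unions of blocks whose $f$-image properly splits $P$. -}

module Defs where

open import Level using (0ℓ)
open import Data.Nat using (ℕ; suc)
open import Data.Fin using (Fin; zero; suc; inject₁; fromℕ)
open import Data.Product using (Σ; ∃; _×_; _,_)
open import Data.Sum using (_⊎_)
open import Data.Empty using (⊥)
open import Relation.Nullary using (¬_)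
open import Relation.Unary using (Pred)
open import Relation.Binary using (Rel; IsEquivalence)
open import Relation.Binary.PropositionalEquality using (_≡_)
open import Function.Bundles using (_⇔_; mk⇔; Equivalence)

record Kripke : Set₁ where
  field
    n     : ℕ
    AP    : Set
    _⟶_   : Rel (Fin n) 0ℓ
    total : ∀ s → ∃ λ t → s ⟶ t
    ℓ     : Fin n → Pred AP 0ℓ        -- labelling (unused by the lemma)

Subset : ℕ → Set₁
Subset n = Pred (Fin n) 0ℓ

∁ : ∀ {n} → Subset n → Subset n
∁ S s = ¬ S s

module _ (K : Kripke) where
  open Kripke K

  EU : Subset n → Subset n → Subset n
  EU S₁ S₂ s =
    S₂ s ⊎
    (S₁ s × Σ ℕ λ k → Σ (Fin (suc k) → Fin n) λ p →
        (p zero ≡ s)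
      × (∀ (i : Fin k) → S₁ (p (inject₁ i)) × (p (inject₁ i) ⟶ p (suc i)))
      × S₂ (p (fromℕ k)))

-- Partitions of Fin n, represented by their equivalence relations
-- (two states are related iff they lie in the same block).
record Partition (n : ℕ) : Set₁ where
  field
    rel   : Rel (Fin n) 0ℓ
    isEqv : IsEquivalence rel
open Partition public

_≐_ : ∀ {n} → Partition n → Partition n → Set
P ≐ Q = ∀ s t → rel P s t ⇔ rel Q s t

_⪯_ : ∀ {n} → Partition n → Partition n → Set
P ⪯ Q = ∀ s t → rel P s t → rel Q s t

_≺_ : ∀ {n} → Partition n → Partition n → Set
P ≺ Q = P ⪯ Q × ¬ (Q ⪯ P)

IsBlock : ∀ {n} → Partition n → Subset n → Set
IsBlock P B = Σ _ λ s → ∀ t → B t ⇔ rel P s t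

-- S is a union of blocks of P (i.e. S ∈ pad(P)): S contains the whole block of each of its elements.
IsUnionOfBlocks : ∀ {n} → Partition n → Subset n → Set
IsUnionOfBlocks P S = ∀ s t → S s → rel P s t → S t

-- P ⋏ {S, ∁S}: meet of P with the two-block partition given by S.
meet2 : ∀ {n} → Partition n → Subset n → Partition n
meet2 {n} P S = record
  { rel   = λ s t → rel P s t × (S s ⇔ S t)
  ; isEqv = record
    { refl  = IsEquivalence.refl (isEqv P) , mk⇔ (λ x → x) (λ x → x)
    ; sym   = λ { (r , e) → IsEquivalence.sym (isEqv P) r , mk⇔ (Equivalence.from e) (Equivalence.to e) }
    ; trans = λ { (r , e) (r' , e') → IsEquivalence.trans (isEqv P) r r'
                , mk⇔ (λ x → Equivalence.to e' (Equivalence.to e x)) (λ x → Equivalence.from e (Equivalence.from e' x)) }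
    }
  }

module _ (K : Kripke) where
  open Kripke K

  GVsplit : Subset n → Subset n → Partition n → Partition n
  GVsplit B₁ B₂ P = meet2 P (EU K B₁ B₂)

  GVrefinersEmpty : Partition n → Set₁
  GVrefinersEmpty P = ¬ (Σ (Subset n) λ B₁ → Σ (Subset n) λ B₂ →
                          IsBlock P B₁ × IsBlock P B₂ × (GVsplit B₁ B₂ P ≺ P))

  -- refine^Part_EU(⟨S1,S2⟩,P) = par(pad(P) ⊓ M({EU(S1,S2)})) = P ⋏ {EU(S1,S2), ∁EU(S1,S2)}
  refineEU : Subset n → Subset n → Partition n → Partition n
  refineEU S₁ S₂ P = meet2 P (EU K S₁ S₂)

  refinersEUEmpty : Partition n → Set₁
  refinersEUEmpty P = ¬ (Σ (Subset n) λ S₁ → Σ (Subset n) λ S₂ →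
                          IsUnionOfBlocks P S₁ × IsUnionOfBlocks P S₂ × (refineEU S₁ S₂ P ≺ P))

{-# OPTIONS --safe #-}
module Submission where

-- If no pair of blocks splits P, then EU(S₁, S₂) is a union of blocks whenever S₁ and
-- S₂ are: when x ∈ S₁ reaches S₂ through a first step x → t, the pair ⟨[x], [t]⟩ does
-- not split P, so every z ~ x reaches [t] through [x] ⊆ S₁, and [t] ⊆ EU(S₁, S₂) by
-- induction on the path. Membership in a subset is not decidable, so the argument runs
-- in the double-negation monad, which commutes with ∀ over the finite state space.

open import Defs
open import Level using (Level; 0ℓ)
open import Data.Nat using (ℕ; zero; suc)
open import Data.Fin using (Fin; zero; suc; inject₁; fromℕ)
open import Data.Vec.Functional using (_∷_)
open import Data.Product using (Σ; _×_; _,_; proj₂; uncurry)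
open import Data.Sum using (inj₁; inj₂)
open import Function using (_∘_; id)
open import Function.Bundles using (_⇔_; mk⇔; Equivalence)
open import Relation.Binary using (IsEquivalence)
open import Relation.Binary.PropositionalEquality using (_≡_; refl)
open import Relation.Nullary.Negation using (¬_; contradiction; ¬¬-Monad)
open import Relation.Unary using (_⊆_)
open import Effect.Monad using (RawMonad)

open RawMonad (¬¬-Monad {a = 0ℓ}) using (pure; _<$>_; _>>=_)

private
  variable
    a p : Level
    A B : Set a
    m : ℕ

¬¬-pull-→ : (A → ¬ ¬ B) → ¬ ¬ (A → B)
¬¬-pull-→ f ¬g = ¬g (λ x → contradiction (λ y → ¬g (λ _ → y)) (f x))

¬¬-pull-Fin : {P : Fin m → Set p} → (∀ i → ¬ ¬ P i) → ¬ ¬ (∀ i → P i)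
¬¬-pull-Fin {zero}  _ ¬all = ¬all (λ ())
¬¬-pull-Fin {suc m} f ¬all =
  f zero λ p₀ → ¬¬-pull-Fin (f ∘ suc) λ ps → ¬all λ { zero → p₀ ; (suc i) → ps i }

module _ {n : ℕ} (P : Partition n) where
  open IsEquivalence (isEqv P) using () renaming (sym to ~-sym; trans to ~-trans)

  block : Fin n → Subset n
  block = rel P

  block-isBlock : ∀ x → IsBlock P (block x)
  block-isBlock x = x , λ _ → mk⇔ id id

  IsBlock⇒IsUnionOfBlocks : ∀ {B} → IsBlock P B → IsUnionOfBlocks P B
  IsBlock⇒IsUnionOfBlocks (x , B≡[x]) s t Bs s~t =
    Equivalence.from (B≡[x] t) (~-trans (Equivalence.to (B≡[x] s) Bs) s~t)

  meet2-⪯ : ∀ S → meet2 P S ⪯ P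
  meet2-⪯ S s t (s~t , _) = s~t

  IsUnionOfBlocks⇒⪯-meet2 : ∀ {S} → IsUnionOfBlocks P S → P ⪯ meet2 P S
  IsUnionOfBlocks⇒⪯-meet2 closed s t s~t =
    s~t , mk⇔ (λ Ss → closed s t Ss s~t) (λ St → closed t s St (~-sym s~t))

  ⪯-meet2⇒IsUnionOfBlocks : ∀ {S} → P ⪯ meet2 P S → IsUnionOfBlocks P S
  ⪯-meet2⇒IsUnionOfBlocks unsplit s t Ss s~t = Equivalence.to (proj₂ (unsplit s t s~t)) Ss

  ¬¬-IsUnionOfBlocks : ∀ {S} → (∀ s t → S s → rel P s t → ¬ ¬ S t) → ¬ ¬ IsUnionOfBlocks P S
  ¬¬-IsUnionOfBlocks closed =
    ¬¬-pull-Fin λ s → ¬¬-pull-Fin λ t → ¬¬-pull-→ λ Ss → ¬¬-pull-→ (closed s t Ss)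

module _ (K : Kripke) where
  open Kripke K

  private
    variable
      C D S₁ S₂ : Subset n
      s t w x z : Fin n

  -- EU K S₁ S₂ s is definitionally S₂ s ⊎ (S₁ s × UntilPath S₁ S₂ s).
  UntilPath : Subset n → Subset n → Fin n → Set
  UntilPath S₁ S₂ s = Σ ℕ λ k → Σ (Fin (suc k) → Fin n) λ π →
      (π zero ≡ s)
    × (∀ (i : Fin k) → S₁ (π (inject₁ i)) × (π (inject₁ i) ⟶ π (suc i)))
    × S₂ (π (fromℕ k))

  data Reach (S₁ S₂ : Subset n) : Fin n → Set where
    here : S₂ s → Reach S₁ S₂ s
    step : S₁ s → s ⟶ t → Reach S₁ S₂ t → Reach S₁ S₂ s

  UntilPath⇒Reach : UntilPath S₁ S₂ s → Reach S₁ S₂ s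
  UntilPath⇒Reach (k , π , refl , edges , end) = from-start k π edges end
    where
    from-start : ∀ k (π : Fin (suc k) → Fin n) →
      (∀ (i : Fin k) → S₁ (π (inject₁ i)) × (π (inject₁ i) ⟶ π (suc i))) →
      S₂ (π (fromℕ k)) → Reach S₁ S₂ (π zero)
    from-start zero    π edges end = here end
    from-start (suc k) π edges end = uncurry step (edges zero) (from-start k (π ∘ suc) (edges ∘ suc) end)

  Reach⇒UntilPath : Reach S₁ S₂ s → UntilPath S₁ S₂ s
  Reach⇒UntilPath {s = s} (here S₂s) = zero , (λ _ → s) , refl , (λ ()) , S₂s
  Reach⇒UntilPath {s = s} (step S₁s s⟶t r) with Reach⇒UntilPath r
  ... | k , π , refl , edges , end =
    suc k , s ∷ π , refl , (λ { zero → S₁s , s⟶t ; (suc i) → edges i }) , end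

  EU⇒Reach : EU K S₁ S₂ s → Reach S₁ S₂ s
  EU⇒Reach (inj₁ S₂s)         = here S₂s
  EU⇒Reach (inj₂ (_ , until)) = UntilPath⇒Reach until

  Reach⇒EU : Reach S₁ S₂ s → EU K S₁ S₂ s
  Reach⇒EU (here S₂s)        = inj₁ S₂s
  Reach⇒EU r@(step S₁s _ _) = inj₂ (S₁s , Reach⇒UntilPath r)

  Reach-mono : C ⊆ S₁ → (∀ {t} → D t → ¬ ¬ Reach S₁ S₂ t) → Reach C D w → ¬ ¬ Reach S₁ S₂ w
  Reach-mono C⊆S₁ D⇒Reach (here Dw)       = D⇒Reach Dw
  Reach-mono C⊆S₁ D⇒Reach (step Cw w⟶t r) = step (C⊆S₁ Cw) w⟶t <$> Reach-mono C⊆S₁ D⇒Reach r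

  module _ (P : Partition n) where
    open IsEquivalence (isEqv P) using () renaming (refl to ~-refl)

    EU-blocks-closed : GVrefinersEmpty K P → ∀ x t → ¬ ¬ IsUnionOfBlocks P (EU K (block P x) (block P t))
    EU-blocks-closed noGV x t notUnion =
      noGV (block P x , block P t , block-isBlock P x , block-isBlock P t ,
            meet2-⪯ P _ , notUnion ∘ ⪯-meet2⇒IsUnionOfBlocks P)

    ⟶⇒EU-blocks : x ⟶ t → EU K (block P x) (block P t) x
    ⟶⇒EU-blocks {x = x} {t = t} x⟶t =
      Reach⇒EU {S₁ = block P x} {S₂ = block P t} (step ~-refl x⟶t (here ~-refl))

    Reach-closed : GVrefinersEmpty K P → IsUnionOfBlocks P S₁ → IsUnionOfBlocks P S₂ →
                   Reach S₁ S₂ x → rel P x z → ¬ ¬ Reach S₁ S₂ z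
    Reach-closed noGV closed₁ closed₂ (here S₂x) x~z = pure (here (closed₂ _ _ S₂x x~z))
    Reach-closed {x = x} {z = z} noGV closed₁ closed₂ (step {t = t} S₁x x⟶t r) x~z = do
      EUₓₜ-closed ← EU-blocks-closed noGV x t
      let z∈EUₓₜ = EUₓₜ-closed x z (⟶⇒EU-blocks x⟶t) x~z
      Reach-mono (closed₁ x _ S₁x) (Reach-closed noGV closed₁ closed₂ r) (EU⇒Reach z∈EUₓₜ)

    EU-closed : GVrefinersEmpty K P → IsUnionOfBlocks P S₁ → IsUnionOfBlocks P S₂ →
                ¬ ¬ IsUnionOfBlocks P (EU K S₁ S₂)
    EU-closed noGV closed₁ closed₂ = ¬¬-IsUnionOfBlocks P λ s t EUs s~t →
      Reach⇒EU <$> Reach-closed noGV closed₁ closed₂ (EU⇒Reach EUs) s~t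

    GVrefinersEmpty⇒refinersEUEmpty : GVrefinersEmpty K P → refinersEUEmpty K P
    GVrefinersEmpty⇒refinersEUEmpty noGV (S₁ , S₂ , closed₁ , closed₂ , _ , P⋠split) =
      EU-closed noGV closed₁ closed₂ (P⋠split ∘ IsUnionOfBlocks⇒⪯-meet2 P)

    refinersEUEmpty⇒GVrefinersEmpty : refinersEUEmpty K P → GVrefinersEmpty K P
    refinersEUEmpty⇒GVrefinersEmpty noRefiner (B₁ , B₂ , isBlock₁ , isBlock₂ , split) =
      noRefiner (B₁ , B₂ , IsBlock⇒IsUnionOfBlocks P isBlock₁ , IsBlock⇒IsUnionOfBlocks P isBlock₂ , split)

lemma5p1 : (K : Kripke) → (P : Partition (Kripke.n K)) →
    (GVrefinersEmpty K P ⇔ refinersEUEmpty K P)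
    × (∀ (B₁ B₂ : Subset (Kripke.n K)) → IsBlock P B₁ → IsBlock P B₂ →
         GVsplit K B₁ B₂ P ≐ refineEU K B₁ B₂ P)
lemma5p1 K P =
  mk⇔ (GVrefinersEmpty⇒refinersEUEmpty K P) (refinersEUEmpty⇒GVrefinersEmpty K P) ,
  λ _ _ _ _ _ _ → mk⇔ id id
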